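{- Let $G$ be a group and $M$ a $\mathbb{Z}[G]$-module. If $M$ is generated as a $\mathbb{Z}[G]$-module by almost fixed elements, then $M$ is almost fixed.
   Context: An element $P \in M$ is almost fixed (by $G$) if whenever $g,h \in G$ satisfy $(g+h-2)P = 0$, one has $(g-1)P = (h-1)P = 0$. The module $M$ is almost fixed if whenever $g,h \in G$ satisfy $(g+h-2)M = 0$, one has $(g-1)M = (h-1)M = 0$. -}

module Defs where

open import Level using (Level; _⊔_; suc)
open import Algebra.Bundles using (Group; AbelianGroup)
open import Data.Product using (_×_)

-- A ℤ[G]-module, presented (as usual) as an abelian group M together with a
-- left action of G on M by additive group endomorphisms; the action extends
-- uniquely ℤ-linearly to ℤ[G].
record GModule {c ℓ : Level} (G : Group c ℓ) (m ℓm : Level)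
       : Set (c ⊔ ℓ ⊔ suc (m ⊔ ℓm)) where
  module G = Group G
  field
    M : AbelianGroup m ℓm
  open AbelianGroup M public
  infixr 8 _·_
  field
    _·_      : G.Carrier → Carrier → Carrier
    ·-cong   : ∀ {g h x y} → g G.≈ h → x ≈ y → g · x ≈ h · y
    ·-identity : ∀ x → G.ε · x ≈ x
    ·-assoc  : ∀ g h x → (g G.∙ h) · x ≈ g · (h · x)
    ·-distrib : ∀ g x y → g · (x ∙ y) ≈ (g · x) ∙ (g · y)

module _ {c ℓ m ℓm : Level} {G : Group c ℓ} (Mod : GModule G m ℓm) where
  open GModule Mod

  g+h-2 : G.Carrier → G.Carrier → Carrier → Carrier
  g+h-2 g h x = ((g · x) ∙ (h · x)) - (x ∙ x)

  g-1 : G.Carrier → Carrier → Carrier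
  g-1 g x = (g · x) - x

  AlmostFixedElt : Carrier → Set (c ⊔ ℓm)
  AlmostFixedElt P = ∀ g h → g+h-2 g h P ≈ ε → (g-1 g P ≈ ε) × (g-1 h P ≈ ε)

  AlmostFixedModule : Set (c ⊔ m ⊔ ℓm)
  AlmostFixedModule = ∀ g h → (∀ x → g+h-2 g h x ≈ ε)
                       → (∀ x → g-1 g x ≈ ε) × (∀ x → g-1 h x ≈ ε)

  data InSpan {s : Level} (S : Carrier → Set s) : Carrier → Set (c ⊔ m ⊔ ℓm ⊔ s) where
    gen  : ∀ {x} → S x → InSpan S x
    zero : InSpan S ε
    add  : ∀ {x y} → InSpan S x → InSpan S y → InSpan S (x ∙ y)
    neg  : ∀ {x} → InSpan S x → InSpan S (x ⁻¹)
    act  : ∀ g {x} → InSpan S x → InSpan S (g · x)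
    resp : ∀ {x y} → x ≈ y → InSpan S x → InSpan S y

  GeneratedBy : {s : Level} → (Carrier → Set s) → Set (c ⊔ m ⊔ ℓm ⊔ s)
  GeneratedBy S = ∀ x → InSpan S x

-- If (g + h - 2) kills M, then so does its conjugate (k⁻¹gk + k⁻¹hk - 2), since
-- (k⁻¹gk + k⁻¹hk - 2) y = k⁻¹ (g + h - 2) (k y). Hence the set of elements fixed by
-- g for every pair (g, h) killing M is a submodule. It contains every almost fixed
-- element, so it is all of M; the condition on h follows by swapping g and h.
module Submission where

open import Defs
open import Level using (Level)
open import Algebra.Bundles using (Group)
open import Data.Product using (_,_; proj₁)
import Algebra.Properties.Group as GroupProperties
import Algebra.Properties.Loop as LoopProperties
import Relation.Binary.Reasoning.Setoid as SetoidReasoning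

module GModuleProperties {c ℓ m ℓm : Level} {G : Group c ℓ} (Mod : GModule G m ℓm) where
  open GModule Mod
  open GroupProperties group using (loop; inverseʳ-unique; //-cong₂; x∙y⁻¹≈ε⇒x≈y)
  open LoopProperties loop using (identityˡ-unique)
  open SetoidReasoning setoid

  ·-ε : ∀ g → g · ε ≈ ε
  ·-ε g = identityˡ-unique (g · ε) (g · ε)
    (trans (sym (·-distrib g ε ε)) (·-cong G.refl (identityʳ ε)))

  ·-⁻¹ : ∀ g x → g · (x ⁻¹) ≈ (g · x) ⁻¹
  ·-⁻¹ g x = inverseʳ-unique (g · x) (g · (x ⁻¹))
    (trans (sym (·-distrib g x (x ⁻¹))) (trans (·-cong G.refl (inverseʳ x)) (·-ε g)))

  ·-distrib-- : ∀ g x y → g · (x - y) ≈ (g · x) - (g · y)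
  ·-distrib-- g x y = trans (·-distrib g x (y ⁻¹)) (∙-congˡ (·-⁻¹ g y))

  ⁻¹·-cancelˡ : ∀ k y → (k G.⁻¹) · (k · y) ≈ y
  ⁻¹·-cancelˡ k y = trans (sym (·-assoc (k G.⁻¹) k y))
    (trans (·-cong (G.inverseˡ k) refl) (·-identity y))

  ⁻¹·-cancelʳ : ∀ k y → k · ((k G.⁻¹) · y) ≈ y
  ⁻¹·-cancelʳ k y = trans (sym (·-assoc k (k G.⁻¹) y))
    (trans (·-cong (G.inverseʳ k) refl) (·-identity y))

  conjugate : G.Carrier → G.Carrier → G.Carrier
  conjugate k g = (k G.⁻¹ G.∙ g) G.∙ k

  conjugate-· : ∀ k g y → conjugate k g · y ≈ (k G.⁻¹) · (g · (k · y))
  conjugate-· k g y = trans (·-assoc (k G.⁻¹ G.∙ g) k y) (·-assoc (k G.⁻¹) g (k · y))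

  g+h-2-conjugate : ∀ k g h y →
    g+h-2 Mod (conjugate k g) (conjugate k h) y ≈ (k G.⁻¹) · g+h-2 Mod g h (k · y)
  g+h-2-conjugate k g h y = begin
    ((conjugate k g · y) ∙ (conjugate k h · y)) - (y ∙ y)
      ≈⟨ //-cong₂ (∙-cong (conjugate-· k g y) (conjugate-· k h y))
                 (∙-cong (sym (⁻¹·-cancelˡ k y)) (sym (⁻¹·-cancelˡ k y))) ⟩
    ((k⁻¹ · (g · ky)) ∙ (k⁻¹ · (h · ky))) - ((k⁻¹ · ky) ∙ (k⁻¹ · ky))
      ≈⟨ sym (//-cong₂ (·-distrib k⁻¹ (g · ky) (h · ky)) (·-distrib k⁻¹ ky ky)) ⟩
    (k⁻¹ · ((g · ky) ∙ (h · ky))) - (k⁻¹ · (ky ∙ ky))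
      ≈⟨ sym (·-distrib-- k⁻¹ ((g · ky) ∙ (h · ky)) (ky ∙ ky)) ⟩
    k⁻¹ · g+h-2 Mod g h ky ∎
    where
    k⁻¹ = k G.⁻¹
    ky = k · y

  Annihilates : G.Carrier → G.Carrier → Set _
  Annihilates g h = ∀ x → g+h-2 Mod g h x ≈ ε

  annihilates-sym : ∀ {g h} → Annihilates g h → Annihilates h g
  annihilates-sym {g} {h} ann x = trans (∙-congʳ (comm (h · x) (g · x))) (ann x)

  annihilates-conjugate : ∀ k {g h} → Annihilates g h →
                          Annihilates (conjugate k g) (conjugate k h)
  annihilates-conjugate k {g} {h} ann y =
    trans (g+h-2-conjugate k g h y) (trans (·-cong G.refl (ann (k · y))) (·-ε (k G.⁻¹)))

  FixedBy : G.Carrier → Carrier → Set _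
  FixedBy g x = g · x ≈ x

  fixedBy-∙ : ∀ g {x y} → FixedBy g x → FixedBy g y → FixedBy g (x ∙ y)
  fixedBy-∙ g {x} {y} gx≈x gy≈y = trans (·-distrib g x y) (∙-cong gx≈x gy≈y)

  fixedBy-⁻¹ : ∀ g {x} → FixedBy g x → FixedBy g (x ⁻¹)
  fixedBy-⁻¹ g {x} gx≈x = trans (·-⁻¹ g x) (⁻¹-cong gx≈x)

  fixedBy-resp : ∀ g {x y} → x ≈ y → FixedBy g x → FixedBy g y
  fixedBy-resp g x≈y gx≈x = trans (·-cong G.refl (sym x≈y)) (trans gx≈x x≈y)

  fixedBy-conjugate : ∀ k g {x} → FixedBy (conjugate k g) x → FixedBy g (k · x)
  fixedBy-conjugate k g {x} fixed = trans (sym (⁻¹·-cancelʳ k (g · (k · x))))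
    (·-cong G.refl (trans (sym (conjugate-· k g x)) fixed))

  FixedByAnnihilators : Carrier → Set _
  FixedByAnnihilators x = ∀ g h → Annihilates g h → FixedBy g x

  almostFixed⇒fixedByAnnihilators : ∀ {x} → AlmostFixedElt Mod x → FixedByAnnihilators x
  almostFixed⇒fixedByAnnihilators {x} af g h ann =
    x∙y⁻¹≈ε⇒x≈y (g · x) x (proj₁ (af g h (ann x)))

  inSpan⇒fixedByAnnihilators : ∀ {s} {S : Carrier → Set s} →
    (∀ {x} → S x → FixedByAnnihilators x) →
    ∀ {x} → InSpan Mod S x → FixedByAnnihilators x
  inSpan⇒fixedByAnnihilators S⊆F (gen Sx) g h ann = S⊆F Sx g h ann
  inSpan⇒fixedByAnnihilators S⊆F zero g h ann = ·-ε g
  inSpan⇒fixedByAnnihilators S⊆F (add x y) g h ann =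
    fixedBy-∙ g (inSpan⇒fixedByAnnihilators S⊆F x g h ann)
                (inSpan⇒fixedByAnnihilators S⊆F y g h ann)
  inSpan⇒fixedByAnnihilators S⊆F (neg x) g h ann =
    fixedBy-⁻¹ g (inSpan⇒fixedByAnnihilators S⊆F x g h ann)
  inSpan⇒fixedByAnnihilators S⊆F (act k x) g h ann =
    fixedBy-conjugate k g
      (inSpan⇒fixedByAnnihilators S⊆F x (conjugate k g) (conjugate k h)
        (annihilates-conjugate k ann))
  inSpan⇒fixedByAnnihilators S⊆F (resp x≈y x) g h ann =
    fixedBy-resp g x≈y (inSpan⇒fixedByAnnihilators S⊆F x g h ann)

lemma2p5 : {c ℓ m ℓm : Level} (G : Group c ℓ) (Mod : GModule G m ℓm)
             → GeneratedBy Mod (AlmostFixedElt Mod)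
             → AlmostFixedModule Mod
lemma2p5 G Mod generated g h ann =
  (λ x → x≈y⇒x∙y⁻¹≈ε (fixed x g h ann)) ,
  (λ x → x≈y⇒x∙y⁻¹≈ε (fixed x h g (annihilates-sym ann)))
  where
  open GModule Mod using (group)
  open GroupProperties group using (x≈y⇒x∙y⁻¹≈ε)
  open GModuleProperties Mod
  fixed : ∀ x → FixedByAnnihilators x
  fixed x = inSpan⇒fixedByAnnihilators almostFixed⇒fixedByAnnihilators (generated x)
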